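{- For all integers $m\ge1$ and $n\ge0$, $$\sum_{k=0}^n(-1)^{n-k}q^{m(n-k)}S^o[n,k]\equiv 1 \pmod{q^m-q}$$ in the ring $\mathbb{Z}[q]$.
   Context: $[j]=1+q+\cdots+q^{j-1}$, $[j]!=[j]\cdots[1]$. Define $S[0,k]=\delta_{0,k}$ ($k\in\mathbb{Z}$), $S[n,k]=S[n-1,k-1]+[k]S[n-1,k]$ for $n\ge1$ (so these are polynomials in $q$ with integer coefficients), and $S^o[n,k]=[k]!\,S[n,k]$. -}

module Defs where

open import Data.Nat using (ℕ; zero; suc)
open import Data.Integer using (ℤ; +_; 0ℤ; 1ℤ; -1ℤ) renaming (_+_ to _+ℤ_; _*_ to _*ℤ_; -_ to -ℤ_)
open import Data.List using (List; []; _∷_)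
open import Data.Product using (Σ)
open import Relation.Binary.PropositionalEquality using (_≡_)

-- Polynomials in ℤ[q] as coefficient lists, lowest degree first.
-- Trailing zeros are allowed; equality is coefficientwise (_≈ₚ_).
Poly : Set
Poly = List ℤ

coeff : Poly → ℕ → ℤ
coeff []       _       = 0ℤ
coeff (a ∷ p)  zero    = a
coeff (a ∷ p)  (suc i) = coeff p i

infix 4 _≈ₚ_
_≈ₚ_ : Poly → Poly → Set
p ≈ₚ r = ∀ i → coeff p i ≡ coeff r i

infixl 6 _+ₚ_ _-ₚ_
infixl 7 _*ₚ_ _·ₚ_

_+ₚ_ : Poly → Poly → Poly
[]      +ₚ r       = r
(a ∷ p) +ₚ []      = a ∷ p
(a ∷ p) +ₚ (b ∷ r) = (a +ℤ b) ∷ (p +ₚ r)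

_·ₚ_ : ℤ → Poly → Poly
c ·ₚ []      = []
c ·ₚ (a ∷ p) = (c *ℤ a) ∷ (c ·ₚ p)

-ₚ_ : Poly → Poly
-ₚ p = -1ℤ ·ₚ p

_-ₚ_ : Poly → Poly → Poly
p -ₚ r = p +ₚ (-ₚ r)

_*ₚ_ : Poly → Poly → Poly
[]      *ₚ r = []
(a ∷ p) *ₚ r = (a ·ₚ r) +ₚ (0ℤ ∷ (p *ₚ r))

const : ℤ → Poly
const c = c ∷ []

0ₚ 1ₚ qₚ : Poly
0ₚ = []
1ₚ = const 1ℤ
qₚ = 0ℤ ∷ 1ℤ ∷ []

_^ₚ_ : Poly → ℕ → Poly
p ^ₚ zero  = 1ₚ
p ^ₚ suc n = p *ₚ (p ^ₚ n)

_∣ₚ_ : Poly → Poly → Set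
d ∣ₚ p = Σ Poly (λ h → d *ₚ h ≈ₚ p)

_≡_[modₚ_] : Poly → Poly → Poly → Set
p ≡ r [modₚ d ] = d ∣ₚ (p -ₚ r)

sumₚ : ℕ → (ℕ → Poly) → Poly
sumₚ zero    f = f zero
sumₚ (suc n) f = sumₚ n f +ₚ f (suc n)

qint : ℕ → Poly
qint zero    = 0ₚ
qint (suc j) = 1ₚ +ₚ qₚ *ₚ qint j

qfact : ℕ → Poly
qfact zero    = 1ₚ
qfact (suc j) = qint (suc j) *ₚ qfact j

-- q-Stirling numbers of the second kind S[n,k], k ∈ ℤ.
-- S[n,k] = 0 for k < 0 (by induction from S[0,k] = δ_{0,k}),
-- so it suffices to index k by ℕ, with S[n-1,k-1] = 0 when k = 0.
qS : ℕ → ℕ → Poly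
qS zero    zero    = 1ₚ
qS zero    (suc k) = 0ₚ
qS (suc n) zero    = qint zero *ₚ qS n zero
qS (suc n) (suc k) = qS n k +ₚ qint (suc k) *ₚ qS n (suc k)

qSo : ℕ → ℕ → Poly
qSo n k = qfact k *ₚ qS n k

sign : ℕ → ℤ
sign zero    = 1ℤ
sign (suc j) = -ℤ sign j

module Submission where

-- Modulo q^m - q we have q^m ≡ q, so the sum is congruent to its instance m = 1, namely
-- Σ_k (-q)^(n-k) S°[n,k], and this equals 1 exactly. For the latter, induct on n using
-- S°[n+1,k+1] = [k+1] (S°[n,k] + S°[n,k+1]) and [k+1] = 1 + q [k]: the sum for n+1 is the
-- sum for n plus a telescoping sum whose boundary terms vanish because [0] = 0 and S[n,n+1] = 0.

open import Defs
open import Data.Nat using (ℕ; zero; suc; _+_; _∸_; _*_; _≤_; _<_; z≤n; s≤s)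
import Data.Nat.Properties as ℕP
open import Data.Integer using (ℤ; 0ℤ; 1ℤ; -1ℤ) renaming (_+_ to _+ℤ_; _*_ to _*ℤ_; -_ to -ℤ_)
open import Data.Integer.Base using (+-*-rawRing)
import Data.Integer.Properties as ℤP
open import Data.List using ([]; _∷_)
open import Data.Maybe using (Maybe; just; nothing)
open import Data.Product using (_,_)
open import Data.Sum using (inj₁; inj₂)
open import Function using (_∘_)
open import Relation.Nullary using (yes; no)
open import Relation.Binary.PropositionalEquality using (_≡_; refl; sym; trans; cong; cong₂)
open import Algebra.Bundles using (CommutativeMonoid; CommutativeRing)
open import Algebra.Solver.Ring.AlmostCommutativeRing
  using (fromCommutativeRing; _-Raw-AlmostCommutative⟶_)

coeff-+ : ∀ p r i → coeff (p +ₚ r) i ≡ coeff p i +ℤ coeff r i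
coeff-+ []      r       i       = sym (ℤP.+-identityˡ _)
coeff-+ (a ∷ p) []      i       = sym (ℤP.+-identityʳ _)
coeff-+ (a ∷ p) (b ∷ r) zero    = refl
coeff-+ (a ∷ p) (b ∷ r) (suc i) = coeff-+ p r i

coeff-· : ∀ c p i → coeff (c ·ₚ p) i ≡ c *ℤ coeff p i
coeff-· c []      i       = sym (ℤP.*-zeroʳ c)
coeff-· c (a ∷ p) zero    = refl
coeff-· c (a ∷ p) (suc i) = coeff-· c p i

-- A record around _≈ₚ_ (a Π-type) makes it injective in both sides, so they can be inferred.
infix 4 _≋_
record _≋_ (p r : Poly) : Set where
  constructor coeffwise
  field coeff-≡ : p ≈ₚ r
open _≋_

≋-refl : ∀ {p} → p ≋ p
≋-refl = coeffwise λ _ → refl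

≋-sym : ∀ {p r} → p ≋ r → r ≋ p
≋-sym e = coeffwise λ i → sym (coeff-≡ e i)

≋-trans : ∀ {p r s} → p ≋ r → r ≋ s → p ≋ s
≋-trans e f = coeffwise λ i → trans (coeff-≡ e i) (coeff-≡ f i)

∷-cong : ∀ {a b p r} → a ≡ b → p ≋ r → a ∷ p ≋ b ∷ r
∷-cong a≡b e = coeffwise λ { zero → a≡b ; (suc i) → coeff-≡ e i }

0∷[]≋[] : 0ℤ ∷ [] ≋ []
0∷[]≋[] = coeffwise λ { zero → refl ; (suc i) → refl }

+-coeffwise : ∀ p r p′ r′ → (∀ i → coeff p i +ℤ coeff r i ≡ coeff p′ i +ℤ coeff r′ i) →
              p +ₚ r ≋ p′ +ₚ r′
+-coeffwise p r p′ r′ e = coeffwise λ i → trans (coeff-+ p r i) (trans (e i) (sym (coeff-+ p′ r′ i)))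

+-cong : ∀ {p p′ r r′} → p ≋ p′ → r ≋ r′ → p +ₚ r ≋ p′ +ₚ r′
+-cong {p} {p′} {r} {r′} e f = +-coeffwise p r p′ r′ λ i → cong₂ _+ℤ_ (coeff-≡ e i) (coeff-≡ f i)

+-comm : ∀ p r → p +ₚ r ≋ r +ₚ p
+-comm p r = +-coeffwise p r r p λ i → ℤP.+-comm (coeff p i) (coeff r i)

+-assoc : ∀ p r s → (p +ₚ r) +ₚ s ≋ p +ₚ (r +ₚ s)
+-assoc p r s = +-coeffwise (p +ₚ r) s p (r +ₚ s) λ i → trans (cong (_+ℤ coeff s i) (coeff-+ p r i))
  (trans (ℤP.+-assoc (coeff p i) (coeff r i) (coeff s i)) (cong (coeff p i +ℤ_) (sym (coeff-+ r s i))))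

+-identityʳ : ∀ p → p +ₚ [] ≋ p
+-identityʳ p = coeffwise λ i → trans (coeff-+ p [] i) (ℤP.+-identityʳ _)

-‿inverseʳ : ∀ p → p +ₚ -ₚ p ≋ []
-‿inverseʳ p = coeffwise λ i → trans (coeff-+ p (-ₚ p) i)
  (trans (cong (coeff p i +ℤ_) (trans (coeff-· -1ℤ p i) (ℤP.-1*i≡-i (coeff p i)))) (ℤP.+-inverseʳ (coeff p i)))

+-commutativeMonoid : CommutativeMonoid _ _
+-commutativeMonoid = record
  { isCommutativeMonoid = record
    { isMonoid = record
      { isSemigroup = record
        { isMagma = record
          { isEquivalence = record { refl = ≋-refl ; sym = ≋-sym ; trans = ≋-trans }
          ; ∙-cong = +-cong }
        ; assoc = +-assoc }
      ; identity = (λ _ → ≋-refl) , +-identityʳ }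
    ; comm = +-comm } }

open import Algebra.Properties.CommutativeSemigroup
  (CommutativeMonoid.commutativeSemigroup +-commutativeMonoid)
  using (interchange; x∙yz≈y∙xz)

·-cong : ∀ c {p r} → p ≋ r → c ·ₚ p ≋ c ·ₚ r
·-cong c {p} {r} e = coeffwise λ i → trans (coeff-· c p i) (trans (cong (c *ℤ_) (coeff-≡ e i)) (sym (coeff-· c r i)))

·-zeroˡ : ∀ p → 0ℤ ·ₚ p ≋ []
·-zeroˡ p = coeffwise λ i → trans (coeff-· 0ℤ p i) (ℤP.*-zeroˡ (coeff p i))

·-identityˡ : ∀ p → 1ℤ ·ₚ p ≋ p
·-identityˡ p = coeffwise λ i → trans (coeff-· 1ℤ p i) (ℤP.*-identityˡ _)

·-assoc : ∀ a b p → (a *ℤ b) ·ₚ p ≋ a ·ₚ (b ·ₚ p)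
·-assoc a b p = coeffwise λ i → trans (coeff-· (a *ℤ b) p i)
  (trans (ℤP.*-assoc a b _) (sym (trans (coeff-· a (b ·ₚ p) i) (cong (a *ℤ_) (coeff-· b p i)))))

·-distribˡ : ∀ c p r → c ·ₚ (p +ₚ r) ≋ c ·ₚ p +ₚ c ·ₚ r
·-distribˡ c p r = coeffwise λ i → trans (coeff-· c (p +ₚ r) i) (trans (cong (c *ℤ_) (coeff-+ p r i))
  (trans (ℤP.*-distribˡ-+ c _ _) (sym (trans (coeff-+ (c ·ₚ p) (c ·ₚ r) i) (cong₂ _+ℤ_ (coeff-· c p i) (coeff-· c r i))))))

*-congʳ : ∀ p {r r′} → r ≋ r′ → p *ₚ r ≋ p *ₚ r′
*-congʳ []      e = ≋-refl
*-congʳ (a ∷ p) e = +-cong (·-cong a e) (∷-cong refl (*-congʳ p e))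

*-zeroʳ : ∀ p → p *ₚ [] ≋ []
*-zeroʳ []      = ≋-refl
*-zeroʳ (a ∷ p) = ≋-trans (∷-cong refl (*-zeroʳ p)) 0∷[]≋[]

*-∷ʳ : ∀ p b r → p *ₚ (b ∷ r) ≋ b ·ₚ p +ₚ (0ℤ ∷ p *ₚ r)
*-∷ʳ []      b r = ≋-sym 0∷[]≋[]
*-∷ʳ (a ∷ p) b r = ∷-cong (cong (_+ℤ 0ℤ) (ℤP.*-comm a b))
  (≋-trans (+-cong (≋-refl {a ·ₚ r}) (*-∷ʳ p b r)) (x∙yz≈y∙xz (a ·ₚ r) (b ·ₚ p) (0ℤ ∷ p *ₚ r)))

0∷-*ˡ : ∀ p r → (0ℤ ∷ p) *ₚ r ≋ 0ℤ ∷ p *ₚ r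
0∷-*ˡ p r = +-cong (·-zeroˡ r) ≋-refl

*-comm : ∀ p r → p *ₚ r ≋ r *ₚ p
*-comm p []      = *-zeroʳ p
*-comm p (b ∷ r) = ≋-trans (*-∷ʳ p b r) (+-cong ≋-refl (∷-cong refl (*-comm p r)))

*-congˡ : ∀ {p p′} r → p ≋ p′ → p *ₚ r ≋ p′ *ₚ r
*-congˡ {p} {p′} r e = ≋-trans (*-comm p r) (≋-trans (*-congʳ r e) (*-comm r p′))

*-zeroʳ-≋ : ∀ p {r} → r ≋ [] → p *ₚ r ≋ []
*-zeroʳ-≋ p r≋[] = ≋-trans (*-congʳ p r≋[]) (*-zeroʳ p)

*-cong : ∀ {p p′ r r′} → p ≋ p′ → r ≋ r′ → p *ₚ r ≋ p′ *ₚ r′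
*-cong {p′ = p′} {r = r} e f = ≋-trans (*-congˡ r e) (*-congʳ p′ f)

*-distribˡ : ∀ p r s → p *ₚ (r +ₚ s) ≋ p *ₚ r +ₚ p *ₚ s
*-distribˡ []      r s = ≋-refl
*-distribˡ (a ∷ p) r s =
  ≋-trans (+-cong (·-distribˡ a r s) (∷-cong refl (*-distribˡ p r s)))
          (interchange (a ·ₚ r) (a ·ₚ s) (0ℤ ∷ p *ₚ r) (0ℤ ∷ p *ₚ s))

*-distribʳ : ∀ s p r → (p +ₚ r) *ₚ s ≋ p *ₚ s +ₚ r *ₚ s
*-distribʳ s p r = ≋-trans (*-comm (p +ₚ r) s)
  (≋-trans (*-distribˡ s p r) (+-cong (*-comm s p) (*-comm s r)))

·-*ˡ : ∀ a r s → (a ·ₚ r) *ₚ s ≋ a ·ₚ (r *ₚ s)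
·-*ˡ a []      s = ≋-refl
·-*ˡ a (b ∷ r) s = ≋-trans (+-cong (·-assoc a b s) (∷-cong (sym (ℤP.*-zeroʳ a)) (·-*ˡ a r s)))
                           (≋-sym (·-distribˡ a (b ·ₚ s) (0ℤ ∷ r *ₚ s)))

*-assoc : ∀ p r s → (p *ₚ r) *ₚ s ≋ p *ₚ (r *ₚ s)
*-assoc []      r s = ≋-refl
*-assoc (a ∷ p) r s = ≋-trans (*-distribʳ s (a ·ₚ r) (0ℤ ∷ p *ₚ r))
  (+-cong (·-*ˡ a r s) (≋-trans (0∷-*ˡ (p *ₚ r) s) (∷-cong refl (*-assoc p r s))))

*-identityˡ : ∀ p → 1ₚ *ₚ p ≋ p
*-identityˡ p = ≋-trans (+-cong (·-identityˡ p) 0∷[]≋[]) (+-identityʳ p)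

*-identityʳ : ∀ p → p *ₚ 1ₚ ≋ p
*-identityʳ p = ≋-trans (*-comm p 1ₚ) (*-identityˡ p)

polyRing : CommutativeRing _ _
polyRing = record
  { isCommutativeRing = record
    { isRing = record
      { +-isAbelianGroup = record
        { isGroup = record
          { isMonoid = CommutativeMonoid.isMonoid +-commutativeMonoid
          ; inverse = (λ p → ≋-trans (+-comm (-ₚ p) p) (-‿inverseʳ p)) , -‿inverseʳ
          ; ⁻¹-cong = ·-cong -1ℤ }
        ; comm = +-comm }
      ; *-cong = *-cong
      ; *-assoc = *-assoc
      ; *-identity = *-identityˡ , *-identityʳ
      ; distrib = *-distribˡ , *-distribʳ }
    ; *-comm = *-comm } }

constHom : +-*-rawRing -Raw-AlmostCommutative⟶ fromCommutativeRing polyRing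
constHom = record
  { ⟦_⟧    = const
  ; +-homo = λ _ _ → ≋-refl
  ; *-homo = λ _ _ → ∷-cong (sym (ℤP.+-identityʳ _)) ≋-refl
  ; -‿homo = λ a → ∷-cong (sym (ℤP.-1*i≡-i a)) ≋-refl
  ; 0-homo = 0∷[]≋[]
  ; 1-homo = ≋-refl }

const-≟ : (a b : ℤ) → Maybe (const a ≋ const b)
const-≟ a b with a ℤP.≟ b
... | yes refl = just ≋-refl
... | no _     = nothing

open import Algebra.Solver.Ring +-*-rawRing (fromCommutativeRing polyRing) constHom const-≟
  using (solve; _:=_; _:+_; _:*_; _:-_; :-_; con)

open import Relation.Binary.Reasoning.Setoid (CommutativeRing.setoid polyRing)

^-+ : ∀ p a b → p ^ₚ (a + b) ≋ p ^ₚ a *ₚ p ^ₚ b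
^-+ p zero    b = ≋-sym (*-identityˡ _)
^-+ p (suc a) b = ≋-trans (*-congʳ p (^-+ p a b)) (≋-sym (*-assoc p (p ^ₚ a) (p ^ₚ b)))

^-* : ∀ p m j → p ^ₚ (m * j) ≋ (p ^ₚ m) ^ₚ j
^-* p m zero    rewrite ℕP.*-zeroʳ m = ≋-refl
^-* p m (suc j) rewrite ℕP.*-suc m j = ≋-trans (^-+ p m (m * j)) (*-congʳ (p ^ₚ m) (^-* p m j))

·≋const* : ∀ c p → c ·ₚ p ≋ const c *ₚ p
·≋const* c p = ≋-sym (≋-trans (+-cong (≋-refl {c ·ₚ p}) 0∷[]≋[]) (+-identityʳ (c ·ₚ p)))

sign·^ : ∀ p j → sign j ·ₚ p ^ₚ j ≋ (-ₚ p) ^ₚ j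
sign·^ p zero    = ·-identityˡ 1ₚ
sign·^ p (suc j) = begin
    sign (suc j) ·ₚ (p *ₚ p ^ₚ j)
  ≈⟨ ·-cong (sign (suc j)) (*-comm p (p ^ₚ j)) ⟩
    (-ℤ sign j) ·ₚ (p ^ₚ j *ₚ p)
  ≈⟨ ≋-trans (·≋const* (-ℤ sign j) (p ^ₚ j *ₚ p)) (*-congˡ (p ^ₚ j *ₚ p) (∷-cong (sym (ℤP.-1*i≡-i (sign j))) (≋-refl {[]}))) ⟩
    (-ₚ const (sign j)) *ₚ (p ^ₚ j *ₚ p)
  ≈⟨ solve 3 (λ s P p → (:- s) :* (P :* p) := (:- p) :* (s :* P)) ≋-refl (const (sign j)) (p ^ₚ j) p ⟩
    (-ₚ p) *ₚ (const (sign j) *ₚ p ^ₚ j)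
  ≈⟨ *-congʳ (-ₚ p) (≋-trans (≋-sym (·≋const* (sign j) (p ^ₚ j))) (sign·^ p j)) ⟩
    (-ₚ p) *ₚ (-ₚ p) ^ₚ j ∎

sumₚ-cong : ∀ n {f g} → (∀ k → k ≤ n → f k ≋ g k) → sumₚ n f ≋ sumₚ n g
sumₚ-cong zero    e = e zero z≤n
sumₚ-cong (suc n) e = +-cong (sumₚ-cong n (λ k k≤n → e k (ℕP.m≤n⇒m≤1+n k≤n))) (e (suc n) ℕP.≤-refl)

sumₚ-+ : ∀ n (f g : ℕ → Poly) → sumₚ n (λ k → f k +ₚ g k) ≋ sumₚ n f +ₚ sumₚ n g
sumₚ-+ zero    f g = ≋-refl
sumₚ-+ (suc n) f g = ≋-trans (+-cong (sumₚ-+ n f g) ≋-refl) (interchange (sumₚ n f) (sumₚ n g) (f (suc n)) (g (suc n)))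

sumₚ-shift : ∀ n (f : ℕ → Poly) → sumₚ (suc n) f ≋ f 0 +ₚ sumₚ n (f ∘ suc)
sumₚ-shift zero    f = ≋-refl
sumₚ-shift (suc n) f = ≋-trans (+-cong (sumₚ-shift n f) (≋-refl {f (suc (suc n))})) (+-assoc (f 0) _ _)

sumₚ-telescope : ∀ n (f : ℕ → Poly) → sumₚ n (λ k → f k -ₚ f (suc k)) ≋ f 0 -ₚ f (suc n)
sumₚ-telescope zero    f = ≋-refl
sumₚ-telescope (suc n) f = ≋-trans (+-cong (sumₚ-telescope n f) (≋-refl {f (suc n) -ₚ f (suc (suc n))}))
  (solve 3 (λ a b c → (a :- b) :+ (b :- c) := a :- c) ≋-refl (f 0) (f (suc n)) (f (suc (suc n))))

infix 4 _≋_[mod_]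
record _≋_[mod_] (x y d : Poly) : Set where
  constructor _,_
  field
    quotient : Poly
    divides  : d *ₚ quotient ≋ x -ₚ y

mod-refl : ∀ {d} x → x ≋ x [mod d ]
mod-refl {d} x = [] , ≋-trans (*-zeroʳ d) (≋-sym (-‿inverseʳ x))

mod-difference : ∀ x y → x ≋ y [mod x -ₚ y ]
mod-difference x y = 1ₚ , *-identityʳ (x -ₚ y)

mod-resp : ∀ {d x x′ y y′} → x ≋ x′ → y ≋ y′ → x ≋ y [mod d ] → x′ ≋ y′ [mod d ]
mod-resp x≋x′ y≋y′ (h , e) = h , ≋-trans e (+-cong x≋x′ (·-cong -1ℤ y≋y′))

mod-+ : ∀ {d x y u v} → x ≋ y [mod d ] → u ≋ v [mod d ] → x +ₚ u ≋ y +ₚ v [mod d ]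
mod-+ {d} {x} {y} {u} {v} (h , e) (k , f) = h +ₚ k , (begin
    d *ₚ (h +ₚ k)       ≈⟨ *-distribˡ d h k ⟩
    d *ₚ h +ₚ d *ₚ k    ≈⟨ +-cong e f ⟩
    (x -ₚ y) +ₚ (u -ₚ v) ≈⟨ solve 4 (λ x y u v → (x :- y) :+ (u :- v) := (x :+ u) :- (y :+ v)) ≋-refl x y u v ⟩
    (x +ₚ u) -ₚ (y +ₚ v) ∎)

mod-* : ∀ {d x y u v} → x ≋ y [mod d ] → u ≋ v [mod d ] → x *ₚ u ≋ y *ₚ v [mod d ]
mod-* {d} {x} {y} {u} {v} (h , e) (k , f) = h *ₚ u +ₚ y *ₚ k , (begin
    d *ₚ (h *ₚ u +ₚ y *ₚ k)
  ≈⟨ solve 5 (λ d h u y k → d :* (h :* u :+ y :* k) := (d :* h) :* u :+ y :* (d :* k)) ≋-refl d h u y k ⟩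
    (d *ₚ h) *ₚ u +ₚ y *ₚ (d *ₚ k)
  ≈⟨ +-cong (*-congˡ u e) (*-congʳ y f) ⟩
    (x -ₚ y) *ₚ u +ₚ y *ₚ (u -ₚ v)
  ≈⟨ solve 4 (λ x y u v → (x :- y) :* u :+ y :* (u :- v) := x :* u :- y :* v) ≋-refl x y u v ⟩
    x *ₚ u -ₚ y *ₚ v ∎)

mod-neg : ∀ {d x y} → x ≋ y [mod d ] → -ₚ x ≋ -ₚ y [mod d ]
mod-neg {d} {x} {y} (h , e) = -ₚ h , (begin
    d *ₚ (-ₚ h)  ≈⟨ solve 2 (λ d h → d :* (:- h) := :- (d :* h)) ≋-refl d h ⟩
    -ₚ (d *ₚ h)  ≈⟨ ·-cong -1ℤ e ⟩
    -ₚ (x -ₚ y)  ≈⟨ solve 2 (λ x y → :- (x :- y) := (:- x) :- (:- y)) ≋-refl x y ⟩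
    -ₚ x -ₚ -ₚ y ∎)

mod-^ : ∀ {d x y} j → x ≋ y [mod d ] → x ^ₚ j ≋ y ^ₚ j [mod d ]
mod-^ zero    e = mod-refl 1ₚ
mod-^ (suc j) e = mod-* e (mod-^ j e)

mod-sumₚ : ∀ {d} n {f g} → (∀ k → f k ≋ g k [mod d ]) → sumₚ n f ≋ sumₚ n g [mod d ]
mod-sumₚ zero    e = e zero
mod-sumₚ (suc n) e = mod-+ (mod-sumₚ n e) (e (suc n))

∸-suc : ∀ {m n} → m < n → n ∸ m ≡ suc (n ∸ suc m)
∸-suc m<n = ℕP.+-∸-assoc 1 m<n

qS-vanish : ∀ {n k} → n < k → qS n k ≋ 0ₚ
qS-vanish {zero}  {suc k} _         = ≋-refl
qS-vanish {suc n} {suc k} (s≤s n<k) =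
  +-cong (qS-vanish n<k) (*-zeroʳ-≋ (qint (suc k)) (qS-vanish (ℕP.m<n⇒m<1+n n<k)))

qSo-vanish : ∀ {n k} → n < k → qSo n k ≋ 0ₚ
qSo-vanish {k = k} n<k = *-zeroʳ-≋ (qfact k) (qS-vanish n<k)

qSo-suc-zero : ∀ n → qSo (suc n) 0 ≋ 0ₚ
qSo-suc-zero n = *-zeroʳ 1ₚ

qSo-suc : ∀ n k → qSo (suc n) (suc k) ≋ qint (suc k) *ₚ (qSo n k +ₚ qSo n (suc k))
qSo-suc n k = solve 4 (λ I F S S′ → (I :* F) :* (S :+ I :* S′) := I :* (F :* S :+ (I :* F) :* S′))
  ≋-refl (qint (suc k)) (qfact k) (qS n k) (qS n (suc k))

alternatingSo : ℕ → Poly → Poly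
alternatingSo n x = sumₚ n (λ k → (-ₚ x) ^ₚ (n ∸ k) *ₚ qSo n k)

alternatingSo-resp-mod : ∀ {d x y} n → x ≋ y [mod d ] → alternatingSo n x ≋ alternatingSo n y [mod d ]
alternatingSo-resp-mod n e = mod-sumₚ n λ k → mod-* (mod-^ (n ∸ k) (mod-neg e)) (mod-refl (qSo n k))

alternatingSo-q-suc : ∀ n → alternatingSo (suc n) qₚ ≋ alternatingSo n qₚ
alternatingSo-q-suc n = begin
    alternatingSo (suc n) qₚ
  ≈⟨ sumₚ-shift n _ ⟩
    y ^ₚ suc n *ₚ qSo (suc n) 0 +ₚ sumₚ n (λ j → y ^ₚ (n ∸ j) *ₚ qSo (suc n) (suc j))
  ≈⟨ +-cong (*-zeroʳ-≋ (y ^ₚ suc n) (qSo-suc-zero n)) (sumₚ-cong n split) ⟩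
    sumₚ n (λ j → t j +ₚ (w j -ₚ w (suc j)))
  ≈⟨ sumₚ-+ n t (λ j → w j -ₚ w (suc j)) ⟩
    alternatingSo n qₚ +ₚ sumₚ n (λ j → w j -ₚ w (suc j))
  ≈⟨ +-cong (≋-refl {alternatingSo n qₚ}) (sumₚ-telescope n w) ⟩
    alternatingSo n qₚ +ₚ (w 0 -ₚ w (suc n))
  ≈⟨ +-cong (≋-refl {alternatingSo n qₚ}) (+-cong w-first (·-cong -1ℤ w-last)) ⟩
    alternatingSo n qₚ +ₚ 0ₚ
  ≈⟨ +-identityʳ _ ⟩
    alternatingSo n qₚ ∎
  where
  y : Poly
  y = -ₚ qₚ
  t w : ℕ → Poly
  t j = y ^ₚ (n ∸ j) *ₚ qSo n j
  w j = y ^ₚ (n ∸ j) *ₚ (qₚ *ₚ (qint j *ₚ qSo n j))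

  w-first : w 0 ≋ 0ₚ
  w-first = *-zeroʳ-≋ (y ^ₚ n) (*-zeroʳ qₚ)

  w-last : w (suc n) ≋ 0ₚ
  w-last = *-zeroʳ-≋ (y ^ₚ (n ∸ suc n)) (*-zeroʳ-≋ qₚ (*-zeroʳ-≋ (qint (suc n)) (qSo-vanish (ℕP.n<1+n n))))

  flip : ∀ j → j ≤ n → y ^ₚ (n ∸ j) *ₚ (qint (suc j) *ₚ qSo n (suc j)) ≋ -ₚ w (suc j)
  flip j j≤n with ℕP.m≤n⇒m<n∨m≡n j≤n
  ... | inj₁ j<n rewrite ∸-suc j<n =
    solve 3 (λ q E X → (:- q) :* E :* X := :- (E :* (q :* X))) ≋-refl qₚ (y ^ₚ (n ∸ suc j)) (qint (suc j) *ₚ qSo n (suc j))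
  ... | inj₂ refl = ≋-trans (*-zeroʳ-≋ (y ^ₚ (n ∸ n)) (*-zeroʳ-≋ (qint (suc n)) (qSo-vanish (ℕP.n<1+n n))))
                            (≋-sym (·-cong -1ℤ w-last))

  split : ∀ j → j ≤ n → y ^ₚ (n ∸ j) *ₚ qSo (suc n) (suc j) ≋ t j +ₚ (w j -ₚ w (suc j))
  split j j≤n = begin
      Y *ₚ qSo (suc n) (suc j)
    ≈⟨ *-congʳ Y (qSo-suc n j) ⟩
      Y *ₚ ((1ₚ +ₚ qₚ *ₚ qint j) *ₚ (qSo n j +ₚ qSo n (suc j)))
    ≈⟨ solve 5 (λ Y q I A B → Y :* ((con 1ℤ :+ q :* I) :* (A :+ B))
                  := Y :* A :+ (Y :* (q :* (I :* A)) :+ Y :* ((con 1ℤ :+ q :* I) :* B)))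
         ≋-refl Y qₚ (qint j) (qSo n j) (qSo n (suc j)) ⟩
      t j +ₚ (w j +ₚ Y *ₚ (qint (suc j) *ₚ qSo n (suc j)))
    ≈⟨ +-cong (≋-refl {t j}) (+-cong (≋-refl {w j}) (flip j j≤n)) ⟩
      t j +ₚ (w j -ₚ w (suc j)) ∎
    where
    Y : Poly
    Y = y ^ₚ (n ∸ j)

alternatingSo-q : ∀ n → alternatingSo n qₚ ≋ 1ₚ
alternatingSo-q zero    = ≋-refl
alternatingSo-q (suc n) = ≋-trans (alternatingSo-q-suc n) (alternatingSo-q n)

sign·^*≋neg^* : ∀ p m j s → sign j ·ₚ (p ^ₚ (m * j) *ₚ s) ≋ (-ₚ (p ^ₚ m)) ^ₚ j *ₚ s
sign·^*≋neg^* p m j s = begin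
    sign j ·ₚ (p ^ₚ (m * j) *ₚ s)  ≈⟨ ≋-sym (·-*ˡ (sign j) (p ^ₚ (m * j)) s) ⟩
    sign j ·ₚ p ^ₚ (m * j) *ₚ s    ≈⟨ *-congˡ s (·-cong (sign j) (^-* p m j)) ⟩
    sign j ·ₚ (p ^ₚ m) ^ₚ j *ₚ s   ≈⟨ *-congˡ s (sign·^ (p ^ₚ m) j) ⟩
    (-ₚ (p ^ₚ m)) ^ₚ j *ₚ s        ∎

theorem5p10 : (m n : ℕ) → 1 ≤ m →
    sumₚ n (λ k → sign (n ∸ k) ·ₚ ((qₚ ^ₚ (m * (n ∸ k))) *ₚ qSo n k))
      ≡ 1ₚ [modₚ (qₚ ^ₚ m) -ₚ qₚ ]
theorem5p10 m n _ = quotient , coeff-≡ divides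
  where
  alternatingSo≋sum : alternatingSo n (qₚ ^ₚ m) ≋ sumₚ n (λ k → sign (n ∸ k) ·ₚ ((qₚ ^ₚ (m * (n ∸ k))) *ₚ qSo n k))
  alternatingSo≋sum = sumₚ-cong n λ k _ → ≋-sym (sign·^*≋neg^* qₚ m (n ∸ k) (qSo n k))

  open _≋_[mod_] (mod-resp alternatingSo≋sum (alternatingSo-q n)
                    (alternatingSo-resp-mod n (mod-difference (qₚ ^ₚ m) qₚ)))
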